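{- Let $(F_n(z))_{n\geq 1}$ be the Gandhi polynomials, defined by $F_1(z)=1$ and $F_{n+1}(z)=(z+1)^2F_n(z+1)-z^2F_n(z)$ for $n\geq 1$. Let $(G_{2n})_{n\geq1}$ be the Genocchi numbers of the first kind and let $t(m,j)$ be the central factorial numbers of the first kind. Then for all integers $n\geq 1$ and $m\geq 0$, \[ F_n(m)\,(m!)^2=\sum_{j=0}^{m}(-1)^{m+j}\,t(m,j)\,G_{2n+2j}. \]
   Context: The Genocchi numbers of the first kind are defined by $\frac{2t}{e^t+1}=t+\sum_{n\geq1}(-1)^nG_{2n}\frac{t^{2n}}{(2n)!}$. Stirling type numbers for a sequence $(a_n)_{n\geq1}$: $t(n,j)$ is defined by $t(n+1,j)=t(n,j-1)-a_nt(n,j)$, with $t(n,0)=\delta_{n,0}$ and $t(n,j)=0$ for $n<j$ (equivalently $t(t-a_1)\cdots(t-a_{n-1})=\sum_{j=0}^n t(n,j)t^j$). The central factorial numbers of the first kind are the numbers $t(n,j)$ for $a_n=n^2$. -}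

module Defs where

open import Data.Nat as ℕ using (ℕ; zero; suc; _≡ᵇ_; _%_; _/_)
open import Data.Nat.Combinatorics using (_C_)
open import Data.Bool using (Bool; true; false; if_then_else_; _∧_; not)
open import Data.Integer as ℤ using (ℤ; +_)
open import Data.Rational as ℚ using (ℚ; 0ℚ; 1ℚ)
open import Relation.Binary.PropositionalEquality using (_≡_)

ℤ→ℚ : ℤ → ℚ
ℤ→ℚ z = z ℚ./ 1

ℕ→ℚ : ℕ → ℚ
ℕ→ℚ n = + n ℚ./ 1

sgn : ℕ → ℚ
sgn zero = 1ℚ
sgn (suc n) = ℚ.- sgn n

sumTo : ℕ → (ℕ → ℚ) → ℚ
sumTo zero f = f 0
sumTo (suc m) f = sumTo m f ℚ.+ f (suc m)

-- Gandhi polynomials evaluated at an integer: F n z = F_n(z) for n ≥ 1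
-- (F 0 is an unused junk value).
F : ℕ → ℤ → ℤ
F zero z = + 0
F (suc zero) z = + 1
F (suc (suc n)) z =
  ((z ℤ.+ + 1) ℤ.* (z ℤ.+ + 1)) ℤ.* F (suc n) (z ℤ.+ + 1) ℤ.- (z ℤ.* z) ℤ.* F (suc n) z

-- Stirling type numbers t(n,j) for the sequence a_n = n^2
-- (central factorial numbers of the first kind):
-- t(0,0)=1, t(0,j+1)=0, t(n+1,0)=0, t(n+1,j+1) = t(n,j) - n^2 t(n,j+1).
cfn : ℕ → ℕ → ℤ
cfn zero zero = + 1
cfn zero (suc j) = + 0
cfn (suc n) zero = + 0
cfn (suc n) (suc j) = cfn n j ℤ.- (+ (n ℕ.* n)) ℤ.* cfn n (suc j)

-- Given G with G n standing for the Genocchi number G_{2n} (n ≥ 1),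
-- genCoef G k is the k-th exponential coefficient of
--   t + Σ_{n≥1} (-1)^n G_{2n} t^{2n}/(2n)!
genCoef : (ℕ → ℚ) → ℕ → ℚ
genCoef G k =
  if k ≡ᵇ 1 then 1ℚ
  else if ((k % 2) ≡ᵇ 0) ∧ not (k ≡ᵇ 0) then sgn (k / 2) ℚ.* G (k / 2)
  else 0ℚ

-- G are the Genocchi numbers of the first kind: the series
-- g(t) = Σ genCoef G k t^k/k! satisfies (e^t + 1) g(t) = 2t, i.e. comparing
-- coefficients of t^k/k!:  Σ_{i=0}^k C(k,i) g_i + g_k = 2·[k = 1].
IsGenocchi : (ℕ → ℚ) → Set
IsGenocchi G = ∀ k →
  sumTo k (λ i → ℕ→ℚ (k C i) ℚ.* genCoef G i) ℚ.+ genCoef G k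
    ≡ (if k ≡ᵇ 1 then ℕ→ℚ 2 else 0ℚ)

module Submission where

-- Let L be the linear functional on polynomials sending Xⁱ to the i-th exponential
-- coefficient gᵢ of 2t/(eᵗ + 1), so g₂ⱼ = (-1)ʲ G₂ⱼ for j ≥ 1. Comparing coefficients in
-- (eᵗ + 1) Σ gᵢ tⁱ/i! = 2t gives L(p(X + 1)) + L(p(X)) = 2 p′(0) for every polynomial p.
-- For W = (X + s)(X + s - 1) ⋯ (X - s - 1) we have W(X + 1) + W(X) = 2X·Z with
-- Z = (X + s) ⋯ (X - s), and X·Z = X²(X² - 1²) ⋯ (X² - s²) = Σⱼ t(s + 1, j) X²ʲ, so
-- Σⱼ t(s + 1, j) g₂ⱼ = W′(0) = (-1)ˢ⁺¹ s! (s + 1)!.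
-- The recurrence of the t(m, j) shows that H(n, m) = Σⱼ (-1)ᵐ⁺ʲ t(m, j) G₂ₙ₊₂ⱼ satisfies
-- H(n, m + 1) = H(n + 1, m) + m² H(n, m), which is also the recurrence of F_n(m) (m!)², and
-- that H(1, m) = (-1)ᵐ⁺¹ (S(m + 1) + m² S(m)) with S(k) = Σⱼ t(k, j) g₂ⱼ. By the evaluation
-- above this is (m!)² = F₁(m) (m!)², and induction on n concludes.

open import Data.Bool.Base using (false; if_then_else_)
open import Data.Nat.Base as ℕ using (ℕ; zero; suc; _!; _≤_; _<_; z≤n; s≤s; _≡ᵇ_)
import Data.Nat.Properties as ℕₚ
open import Data.Nat.Combinatorics using (_C_; k>n⇒nCk≡0; nCk+nC[k+1]≡[n+1]C[k+1])
open import Data.Nat.DivMod using (m*n%n≡0; m*n/n≡m)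
import Data.Nat.Tactic.RingSolver as ℕ-Solver
open import Data.Integer.Base as ℤ using (+_; +[1+_]; -[1+_])
import Data.Integer.Properties as ℤₚ
open import Data.Rational.Base using (ℚ; 0ℚ; 1ℚ; ½; toℚᵘ; fromℚᵘ)
import Data.Rational.Properties as ℚₚ
open import Function.Base using (_∘_)
open import Relation.Binary.PropositionalEquality
open import Relation.Nullary.Decidable using (dec⇒maybe)
open import Tactic.RingSolver using (solve-∀)
open import Tactic.RingSolver.Core.AlmostCommutativeRing using (AlmostCommutativeRing; fromCommutativeRing)
import Relation.Binary.Reasoning.Setoid as SetoidReasoning

open import Defs

ℚ-ring : AlmostCommutativeRing _ _
ℚ-ring = fromCommutativeRing ℚₚ.+-*-commutativeRing (λ x → dec⇒maybe (0ℚ ℚₚ.≟ x))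

module Arithmetic where

  open import Data.Rational.Base using (_+_; _*_; -_; _-_)
  open import Data.Rational.Unnormalised.Base as ℚᵘ using (ℚᵘ; mkℚᵘ; _≃_; *≡*)
  import Data.Rational.Unnormalised.Properties as ℚᵘₚ

  private
    fromℚᵘ-homo : (_∙_ : ℚ → ℚ → ℚ) (_∙ᵘ_ : ℚᵘ → ℚᵘ → ℚᵘ) →
                  (∀ p q → toℚᵘ (p ∙ q) ≃ toℚᵘ p ∙ᵘ toℚᵘ q) →
                  (∀ {p p′ q q′} → p ≃ p′ → q ≃ q′ → (p ∙ᵘ q) ≃ (p′ ∙ᵘ q′)) →
                  ∀ p q → fromℚᵘ (p ∙ᵘ q) ≡ fromℚᵘ p ∙ fromℚᵘ q
    fromℚᵘ-homo _∙_ _∙ᵘ_ homo ∙ᵘ-cong p q = ℚₚ.toℚᵘ-injective (begin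
      toℚᵘ (fromℚᵘ (p ∙ᵘ q))              ≈⟨ ℚₚ.toℚᵘ-fromℚᵘ (p ∙ᵘ q) ⟩
      p ∙ᵘ q                              ≈⟨ ∙ᵘ-cong (back p) (back q) ⟩
      toℚᵘ (fromℚᵘ p) ∙ᵘ toℚᵘ (fromℚᵘ q)  ≈⟨ ℚᵘₚ.≃-sym (homo (fromℚᵘ p) (fromℚᵘ q)) ⟩
      toℚᵘ (fromℚᵘ p ∙ fromℚᵘ q)          ∎)
      where
      open ℚᵘₚ.≃-Reasoning
      back : ∀ r → r ≃ toℚᵘ (fromℚᵘ r)
      back r = ℚᵘₚ.≃-sym (ℚₚ.toℚᵘ-fromℚᵘ r)

  -- ℤ→ℚ z reduces to fromℚᵘ (mkℚᵘ z 0), so the homomorphism laws are inherited from ℚᵘ.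
  ℤ→ℚ-homo-* : ∀ a b → ℤ→ℚ (a ℤ.* b) ≡ ℤ→ℚ a * ℤ→ℚ b
  ℤ→ℚ-homo-* a b = fromℚᵘ-homo _*_ ℚᵘ._*_ ℚₚ.toℚᵘ-homo-* ℚᵘₚ.*-cong (mkℚᵘ a 0) (mkℚᵘ b 0)

  ℤ→ℚ-homo-+ : ∀ a b → ℤ→ℚ (a ℤ.+ b) ≡ ℤ→ℚ a + ℤ→ℚ b
  ℤ→ℚ-homo-+ a b = trans
    (ℚₚ.fromℚᵘ-cong ℚᵘ-sum)
    (fromℚᵘ-homo _+_ ℚᵘ._+_ ℚₚ.toℚᵘ-homo-+ ℚᵘₚ.+-cong (mkℚᵘ a 0) (mkℚᵘ b 0))
    where
    ℚᵘ-sum : mkℚᵘ (a ℤ.+ b) 0 ≃ mkℚᵘ a 0 ℚᵘ.+ mkℚᵘ b 0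
    ℚᵘ-sum = *≡* (cong (ℤ._* + 1) (cong₂ ℤ._+_ (sym (ℤₚ.*-identityʳ a)) (sym (ℤₚ.*-identityʳ b))))

  ℤ→ℚ-homo-‿ : ∀ a → ℤ→ℚ (ℤ.- a) ≡ - ℤ→ℚ a
  ℤ→ℚ-homo-‿ (+ zero) = refl
  ℤ→ℚ-homo-‿ +[1+ n ] = refl
  ℤ→ℚ-homo-‿ -[1+ n ] = neg-involutive (ℤ→ℚ (+ suc n))
    where
    neg-involutive : ∀ p → p ≡ - - p
    neg-involutive = solve-∀ ℚ-ring

  ℤ→ℚ-homo-sub : ∀ a b → ℤ→ℚ (a ℤ.- b) ≡ ℤ→ℚ a - ℤ→ℚ b
  ℤ→ℚ-homo-sub a b = trans (ℤ→ℚ-homo-+ a (ℤ.- b)) (cong (λ q → ℤ→ℚ a + q) (ℤ→ℚ-homo-‿ b))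

  ℕ→ℚ-homo-+ : ∀ m n → ℕ→ℚ (m ℕ.+ n) ≡ ℕ→ℚ m + ℕ→ℚ n
  ℕ→ℚ-homo-+ m n = trans (cong ℤ→ℚ (ℤₚ.pos-+ m n)) (ℤ→ℚ-homo-+ (+ m) (+ n))

  ℕ→ℚ-homo-* : ∀ m n → ℕ→ℚ (m ℕ.* n) ≡ ℕ→ℚ m * ℕ→ℚ n
  ℕ→ℚ-homo-* m n = trans (cong ℤ→ℚ (ℤₚ.pos-* m n)) (ℤ→ℚ-homo-* (+ m) (+ n))

  ℕ→ℚ-suc : ∀ n → ℕ→ℚ (suc n) ≡ 1ℚ + ℕ→ℚ n
  ℕ→ℚ-suc = ℕ→ℚ-homo-+ 1

  neg-ℕ→ℚ-suc+1 : ∀ n → - ℕ→ℚ (suc n) + 1ℚ ≡ - ℕ→ℚ n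
  neg-ℕ→ℚ-suc+1 n = trans (cong (λ x → - x + 1ℚ) (ℕ→ℚ-suc n)) (cancel (ℕ→ℚ n))
    where
    cancel : ∀ x → - (1ℚ + x) + 1ℚ ≡ - x
    cancel = solve-∀ ℚ-ring

  2*-injective : ∀ {x y} → ℕ→ℚ 2 * x ≡ ℕ→ℚ 2 * y → x ≡ y
  2*-injective {x} {y} 2x≡2y = trans (halve x) (trans (cong (½ *_) 2x≡2y) (sym (halve y)))
    where
    halve : ∀ z → z ≡ ½ * (ℕ→ℚ 2 * z)
    halve = solve-∀ ℚ-ring

  n+n≡n*2 : ∀ n → n ℕ.+ n ≡ n ℕ.* 2
  n+n≡n*2 = ℕ-Solver.solve-∀

  factorial²-suc : ∀ m → ℕ→ℚ (suc m ! ℕ.* suc m !) ≡ ℕ→ℚ (suc m ℕ.* suc m) * ℕ→ℚ (m ! ℕ.* m !)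
  factorial²-suc m =
    trans (cong ℕ→ℚ (interchange (suc m) (m !))) (ℕ→ℚ-homo-* (suc m ℕ.* suc m) (m ! ℕ.* m !))
    where
    interchange : ∀ a f → (a ℕ.* f) ℕ.* (a ℕ.* f) ≡ (a ℕ.* a) ℕ.* (f ℕ.* f)
    interchange = ℕ-Solver.solve-∀

  sgn-homo-+ : ∀ m n → sgn (m ℕ.+ n) ≡ sgn m * sgn n
  sgn-homo-+ zero    n = sym (ℚₚ.*-identityˡ (sgn n))
  sgn-homo-+ (suc m) n = trans (cong -_ (sgn-homo-+ m n)) (ℚₚ.neg-distribˡ-* (sgn m) (sgn n))

  sgn*sgn : ∀ n → sgn n * sgn n ≡ 1ℚ
  sgn*sgn zero    = refl
  sgn*sgn (suc n) = trans (neg*neg (sgn n)) (sgn*sgn n)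
    where
    neg*neg : ∀ p → - p * - p ≡ p * p
    neg*neg = solve-∀ ℚ-ring

module Sums where

  open import Data.Rational.Base using (_+_; _*_; -_; _-_)

  sumTo-cong-≤ : ∀ N {f g : ℕ → ℚ} → (∀ i → i ≤ N → f i ≡ g i) → sumTo N f ≡ sumTo N g
  sumTo-cong-≤ zero    f≡g = f≡g 0 z≤n
  sumTo-cong-≤ (suc N) f≡g =
    cong₂ _+_ (sumTo-cong-≤ N (λ i i≤N → f≡g i (ℕₚ.m≤n⇒m≤1+n i≤N))) (f≡g (suc N) ℕₚ.≤-refl)

  sumTo-cong : ∀ N {f g : ℕ → ℚ} → f ≗ g → sumTo N f ≡ sumTo N g
  sumTo-cong N f≗g = sumTo-cong-≤ N (λ i _ → f≗g i)

  sumTo-zero : ∀ N (f : ℕ → ℚ) → (∀ i → f i ≡ 0ℚ) → sumTo N f ≡ 0ℚ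
  sumTo-zero zero    f f≡0 = f≡0 0
  sumTo-zero (suc N) f f≡0 = cong₂ _+_ (sumTo-zero N f f≡0) (f≡0 (suc N))

  sumTo-distrib-+ : ∀ N (f g : ℕ → ℚ) → sumTo N (λ i → f i + g i) ≡ sumTo N f + sumTo N g
  sumTo-distrib-+ zero    f g = refl
  sumTo-distrib-+ (suc N) f g = begin
    sumTo N (λ i → f i + g i) + (f (suc N) + g (suc N))
      ≡⟨ cong (_+ (f (suc N) + g (suc N))) (sumTo-distrib-+ N f g) ⟩
    (sumTo N f + sumTo N g) + (f (suc N) + g (suc N))
      ≡⟨ interchange (sumTo N f) (sumTo N g) (f (suc N)) (g (suc N)) ⟩
    (sumTo N f + f (suc N)) + (sumTo N g + g (suc N)) ∎
    where
    open ≡-Reasoning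
    interchange : ∀ a b c d → (a + b) + (c + d) ≡ (a + c) + (b + d)
    interchange = solve-∀ ℚ-ring

  sumTo-distribˡ-* : ∀ N a (f : ℕ → ℚ) → sumTo N (λ i → a * f i) ≡ a * sumTo N f
  sumTo-distribˡ-* zero    a f = refl
  sumTo-distribˡ-* (suc N) a f =
    trans (cong (_+ a * f (suc N)) (sumTo-distribˡ-* N a f)) (sym (ℚₚ.*-distribˡ-+ a (sumTo N f) (f (suc N))))

  sumTo-distribʳ-* : ∀ N a (f : ℕ → ℚ) → sumTo N (λ i → f i * a) ≡ sumTo N f * a
  sumTo-distribʳ-* zero    a f = refl
  sumTo-distribʳ-* (suc N) a f =
    trans (cong (_+ f (suc N) * a) (sumTo-distribʳ-* N a f)) (sym (ℚₚ.*-distribʳ-+ a (sumTo N f) (f (suc N))))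

  sumTo-neg : ∀ N (f : ℕ → ℚ) → sumTo N (λ i → - f i) ≡ - sumTo N f
  sumTo-neg zero    f = refl
  sumTo-neg (suc N) f =
    trans (cong (_+ - f (suc N)) (sumTo-neg N f)) (sym (ℚₚ.neg-distrib-+ (sumTo N f) (f (suc N))))

  sumTo-sub : ∀ N (f g : ℕ → ℚ) → sumTo N (λ i → f i - g i) ≡ sumTo N f - sumTo N g
  sumTo-sub N f g = trans (sumTo-distrib-+ N f (λ i → - g i)) (cong (λ s → sumTo N f + s) (sumTo-neg N g))

  sumTo-head : ∀ N (f : ℕ → ℚ) → sumTo (suc N) f ≡ f 0 + sumTo N (f ∘ suc)
  sumTo-head zero    f = refl
  sumTo-head (suc N) f =
    trans (cong (_+ f (suc (suc N))) (sumTo-head N f)) (ℚₚ.+-assoc (f 0) (sumTo N (f ∘ suc)) (f (suc (suc N))))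

  sumTo-swap : ∀ N M (f : ℕ → ℕ → ℚ) →
               sumTo N (λ i → sumTo M (f i)) ≡ sumTo M (λ k → sumTo N (λ i → f i k))
  sumTo-swap zero    M f = refl
  sumTo-swap (suc N) M f =
    trans (cong (_+ sumTo M (f (suc N))) (sumTo-swap N M f))
          (sym (sumTo-distrib-+ M (λ k → sumTo N (λ i → f i k)) (f (suc N))))

  sumTo-vanishing-tail : ∀ {k N} (f : ℕ → ℚ) → k ≤ N → (∀ i → k < i → f i ≡ 0ℚ) → sumTo N f ≡ sumTo k f
  sumTo-vanishing-tail {k} {N} f k≤N f≡0 =
    trans (cong (λ n → sumTo n f) (sym (ℕₚ.m∸n+n≡m k≤N))) (pad (N ℕ.∸ k))
    where
    pad : ∀ d → sumTo (d ℕ.+ k) f ≡ sumTo k f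
    pad zero    = refl
    pad (suc d) = trans (cong₂ _+_ (pad d) (f≡0 (suc (d ℕ.+ k)) (s≤s (ℕₚ.m≤n+m k d)))) (ℚₚ.+-identityʳ _)

module Polynomials where

  open import Data.Rational.Base using (_+_; _*_; -_; _-_)
  open Arithmetic
  open Sums

  Poly : Set
  Poly = ℕ → ℚ

  module ≗-Reasoning = SetoidReasoning (ℕ →-setoid ℚ)

  one : Poly
  one zero    = 1ℚ
  one (suc i) = 0ℚ

  infixr 7 X*_ [X-_]*_

  X*_ : Poly → Poly
  (X* c) zero    = 0ℚ
  (X* c) (suc i) = c i

  [X-_]*_ : ℚ → Poly → Poly
  ([X- a ]* c) i = (X* c) i - a * c i

  -- c(X + 1), computed from the coefficients of c of degree at most N
  shift : ℕ → Poly → Poly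
  shift N c i = sumTo N (λ k → ℕ→ℚ (k C i) * c k)

  fallingFactorial : ℚ → ℕ → Poly
  fallingFactorial a zero    = one
  fallingFactorial a (suc l) = [X- a ]* fallingFactorial (a + 1ℚ) l

  apply : (ℕ → ℚ) → ℕ → Poly → ℚ
  apply g N c = sumTo N (λ i → c i * g i)

  X*-cong : ∀ {c d} → c ≗ d → X* c ≗ X* d
  X*-cong c≗d zero    = refl
  X*-cong c≗d (suc i) = c≗d i

  [X-]*-cong : ∀ a {c d} → c ≗ d → [X- a ]* c ≗ [X- a ]* d
  [X-]*-cong a c≗d i = cong₂ (λ x y → x - a * y) (X*-cong c≗d i) (c≗d i)

  [X-]*-at-0 : ∀ a c → ([X- a ]* c) 0 ≡ - (a * c 0)
  [X-]*-at-0 a c = ℚₚ.+-identityˡ (- (a * c 0))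

  X*-[X-]*-comm : ∀ a c → X* [X- a ]* c ≗ [X- a ]* X* c
  X*-[X-]*-comm a c zero    = sym (trans ([X-]*-at-0 a (X* c)) (cong -_ (ℚₚ.*-zeroʳ a)))
  X*-[X-]*-comm a c (suc i) = refl

  [X-]*-comm : ∀ a b c → [X- a ]* [X- b ]* c ≗ [X- b ]* [X- a ]* c
  [X-]*-comm a b c zero    = comm₀ a b (c 0)
    where
    comm₀ : ∀ a b x → 0ℚ - a * (0ℚ - b * x) ≡ 0ℚ - b * (0ℚ - a * x)
    comm₀ = solve-∀ ℚ-ring
  [X-]*-comm a b c (suc i) = comm a b ((X* c) i) (c i) (c (suc i))
    where
    comm : ∀ a b p x y → (p - b * x) - a * (x - b * y) ≡ (p - a * x) - b * (x - a * y)
    comm = solve-∀ ℚ-ring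

  [X-]*-+-[X-]* : ∀ a b c → a + b ≡ 0ℚ → ∀ i → ([X- a ]* c) i + ([X- b ]* c) i ≡ ℕ→ℚ 2 * (X* c) i
  [X-]*-+-[X-]* a b c a+b≡0 i = begin
    (p - a * x) + (p - b * x)  ≡⟨ collect p x a b ⟩
    ℕ→ℚ 2 * p - (a + b) * x    ≡⟨ cong (λ s → ℕ→ℚ 2 * p - s * x) a+b≡0 ⟩
    ℕ→ℚ 2 * p - 0ℚ * x         ≡⟨ drop p x ⟩
    ℕ→ℚ 2 * p                  ∎
    where
    open ≡-Reasoning
    p x : ℚ
    p = (X* c) i
    x = c i
    collect : ∀ p x a b → (p - a * x) + (p - b * x) ≡ ℕ→ℚ 2 * p - (a + b) * x
    collect = solve-∀ ℚ-ring
    drop : ∀ p x → ℕ→ℚ 2 * p - 0ℚ * x ≡ ℕ→ℚ 2 * p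
    drop = solve-∀ ℚ-ring

  fallingFactorial-high : ∀ a l i → l < i → fallingFactorial a l i ≡ 0ℚ
  fallingFactorial-high a zero    (suc i) _         = refl
  fallingFactorial-high a (suc l) (suc i) (s≤s l<i) = trans
    (cong₂ (λ x y → x - a * y) (fallingFactorial-high (a + 1ℚ) l i l<i)
                               (fallingFactorial-high (a + 1ℚ) l (suc i) (ℕₚ.m<n⇒m<1+n l<i)))
    (vanish a)
    where
    vanish : ∀ a → 0ℚ - a * 0ℚ ≡ 0ℚ
    vanish = solve-∀ ℚ-ring

  fallingFactorial-sucʳ : ∀ a l → fallingFactorial a (suc l) ≗ [X- a + ℕ→ℚ l ]* fallingFactorial a l
  fallingFactorial-sucʳ a zero    i = cong (λ b → ([X- b ]* one) i) (sym (ℚₚ.+-identityʳ a))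
  fallingFactorial-sucʳ a (suc l) = begin
    [X- a ]* fallingFactorial (a + 1ℚ) (suc l)
      ≈⟨ [X-]*-cong a (fallingFactorial-sucʳ (a + 1ℚ) l) ⟩
    [X- a ]* [X- a + 1ℚ + ℕ→ℚ l ]* fallingFactorial (a + 1ℚ) l
      ≈⟨ [X-]*-comm a (a + 1ℚ + ℕ→ℚ l) _ ⟩
    [X- a + 1ℚ + ℕ→ℚ l ]* fallingFactorial a (suc l)
      ≡⟨ cong (λ b → [X- b ]* fallingFactorial a (suc l)) shift-root ⟩
    [X- a + ℕ→ℚ (suc l) ]* fallingFactorial a (suc l) ∎
    where
    open ≗-Reasoning
    shift-root : a + 1ℚ + ℕ→ℚ l ≡ a + ℕ→ℚ (suc l)
    shift-root = trans (ℚₚ.+-assoc a 1ℚ (ℕ→ℚ l)) (cong (λ x → a + x) (sym (ℕ→ℚ-suc l)))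

  shift-suc : ∀ M c → c (suc M) ≡ 0ℚ → shift (suc M) c ≗ shift M c
  shift-suc M c c≡0 i =
    trans (cong (λ x → shift M c i + ℕ→ℚ (suc M C i) * x) c≡0) (drop (shift M c i) (ℕ→ℚ (suc M C i)))
    where
    drop : ∀ s b → s + b * 0ℚ ≡ s
    drop = solve-∀ ℚ-ring

  pascal : ∀ k i → ℕ→ℚ (suc k C i) ≡ (X* (λ j → ℕ→ℚ (k C j))) i + ℕ→ℚ (k C i)
  pascal k zero    = refl
  pascal k (suc i) = trans (cong ℕ→ℚ (sym (nCk+nC[k+1]≡[n+1]C[k+1] k i))) (ℕ→ℚ-homo-+ (k C i) (k C suc i))

  shift-X* : ∀ M c i → shift (suc M) (X* c) i ≡ (X* shift M c) i + shift M c i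
  shift-X* M c i = begin
    shift (suc M) (X* c) i
      ≡⟨ sumTo-head M (λ k → ℕ→ℚ (k C i) * (X* c) k) ⟩
    ℕ→ℚ (0 C i) * 0ℚ + sumTo M (λ k → ℕ→ℚ (suc k C i) * c k)
      ≡⟨ cong₂ _+_ (ℚₚ.*-zeroʳ (ℕ→ℚ (0 C i))) (sumTo-cong M (λ k → cong (_* c k) (pascal k i))) ⟩
    0ℚ + sumTo M (λ k → ((X* binomial k) i + ℕ→ℚ (k C i)) * c k)
      ≡⟨ ℚₚ.+-identityˡ _ ⟩
    sumTo M (λ k → ((X* binomial k) i + ℕ→ℚ (k C i)) * c k)
      ≡⟨ sumTo-cong M (λ k → ℚₚ.*-distribʳ-+ (c k) ((X* binomial k) i) (ℕ→ℚ (k C i))) ⟩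
    sumTo M (λ k → (X* binomial k) i * c k + ℕ→ℚ (k C i) * c k)
      ≡⟨ sumTo-distrib-+ M _ _ ⟩
    sumTo M (λ k → (X* binomial k) i * c k) + shift M c i
      ≡⟨ cong (_+ shift M c i) (lower i) ⟩
    (X* shift M c) i + shift M c i ∎
    where
    open ≡-Reasoning
    binomial : ℕ → Poly
    binomial k j = ℕ→ℚ (k C j)
    lower : ∀ i → sumTo M (λ k → (X* binomial k) i * c k) ≡ (X* shift M c) i
    lower zero    = sumTo-zero M _ (λ k → ℚₚ.*-zeroˡ (c k))
    lower (suc i) = refl

  shift-[X-]* : ∀ M a c → c (suc M) ≡ 0ℚ → shift (suc M) ([X- a ]* c) ≗ [X- a - 1ℚ ]* shift (suc M) c
  shift-[X-]* M a c c≡0 i = begin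
    shift (suc M) ([X- a ]* c) i
      ≡⟨ sumTo-cong (suc M) (λ k → distrib (ℕ→ℚ (k C i)) ((X* c) k) a (c k)) ⟩
    sumTo (suc M) (λ k → ℕ→ℚ (k C i) * (X* c) k - a * (ℕ→ℚ (k C i) * c k))
      ≡⟨ sumTo-sub (suc M) _ _ ⟩
    shift (suc M) (X* c) i - sumTo (suc M) (λ k → a * (ℕ→ℚ (k C i) * c k))
      ≡⟨ cong (λ y → shift (suc M) (X* c) i - y) (sumTo-distribˡ-* (suc M) a _) ⟩
    shift (suc M) (X* c) i - a * shift (suc M) c i
      ≡⟨ cong₂ (λ x y → x - a * y) (shift-X* M c i) (shift-suc M c c≡0 i) ⟩
    (X* shift M c) i + shift M c i - a * shift M c i
      ≡⟨ collect ((X* shift M c) i) (shift M c i) a ⟩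
    (X* shift M c) i - (a - 1ℚ) * shift M c i
      ≡⟨ sym ([X-]*-cong (a - 1ℚ) (shift-suc M c c≡0) i) ⟩
    ([X- a - 1ℚ ]* shift (suc M) c) i ∎
    where
    open ≡-Reasoning
    distrib : ∀ b p a x → b * (p - a * x) ≡ b * p - a * (b * x)
    distrib = solve-∀ ℚ-ring
    collect : ∀ p s a → p + s - a * s ≡ p - (a - 1ℚ) * s
    collect = solve-∀ ℚ-ring

  shift-fallingFactorial : ∀ M a l → l ≤ M → shift (suc M) (fallingFactorial a l) ≗ fallingFactorial (a - 1ℚ) l
  shift-fallingFactorial M a zero    _ i = trans
    (sumTo-head M (λ k → ℕ→ℚ (k C i) * one k))
    (trans (cong (λ s → ℕ→ℚ (0 C i) * 1ℚ + s) (sumTo-zero M _ (λ k → ℚₚ.*-zeroʳ (ℕ→ℚ (suc k C i))))) (at i))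
    where
    at : ∀ i → ℕ→ℚ (0 C i) * 1ℚ + 0ℚ ≡ one i
    at zero    = refl
    at (suc i) = refl
  shift-fallingFactorial M a (suc l) l<M = begin
    shift (suc M) ([X- a ]* fallingFactorial (a + 1ℚ) l)
      ≈⟨ shift-[X-]* M a _ (fallingFactorial-high (a + 1ℚ) l (suc M) (ℕₚ.m≤n⇒m≤1+n l<M)) ⟩
    [X- a - 1ℚ ]* shift (suc M) (fallingFactorial (a + 1ℚ) l)
      ≈⟨ [X-]*-cong (a - 1ℚ) (shift-fallingFactorial M (a + 1ℚ) l (ℕₚ.<⇒≤ l<M)) ⟩
    [X- a - 1ℚ ]* fallingFactorial (a + 1ℚ - 1ℚ) l
      ≡⟨ cong (λ b → [X- a - 1ℚ ]* fallingFactorial b l) (swap a) ⟩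
    fallingFactorial (a - 1ℚ) (suc l) ∎
    where
    open ≗-Reasoning
    swap : ∀ a → a + 1ℚ - 1ℚ ≡ a - 1ℚ + 1ℚ
    swap = solve-∀ ℚ-ring

  fallingFactorial-at-0 : ∀ c l → fallingFactorial (ℕ→ℚ (suc c)) l 0 * ℕ→ℚ (c !) ≡ sgn l * ℕ→ℚ ((c ℕ.+ l) !)
  fallingFactorial-at-0 c zero    = cong (λ n → 1ℚ * ℕ→ℚ (n !)) (sym (ℕₚ.+-identityʳ c))
  fallingFactorial-at-0 c (suc l) = begin
    fallingFactorial (ℕ→ℚ (suc c)) (suc l) 0 * ℕ→ℚ (c !)
      ≡⟨ cong (_* ℕ→ℚ (c !)) ([X-]*-at-0 (ℕ→ℚ (suc c)) (fallingFactorial (ℕ→ℚ (suc c) + 1ℚ) l)) ⟩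
    - (ℕ→ℚ (suc c) * fallingFactorial (ℕ→ℚ (suc c) + 1ℚ) l 0) * ℕ→ℚ (c !)
      ≡⟨ cong (λ b → - (ℕ→ℚ (suc c) * fallingFactorial b l 0) * ℕ→ℚ (c !)) next ⟩
    - (ℕ→ℚ (suc c) * fallingFactorial (ℕ→ℚ (suc (suc c))) l 0) * ℕ→ℚ (c !)
      ≡⟨ reassoc (ℕ→ℚ (suc c)) (fallingFactorial (ℕ→ℚ (suc (suc c))) l 0) (ℕ→ℚ (c !)) ⟩
    - (fallingFactorial (ℕ→ℚ (suc (suc c))) l 0 * (ℕ→ℚ (suc c) * ℕ→ℚ (c !)))
      ≡⟨ cong (λ x → - (fallingFactorial (ℕ→ℚ (suc (suc c))) l 0 * x)) (sym (ℕ→ℚ-homo-* (suc c) (c !))) ⟩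
    - (fallingFactorial (ℕ→ℚ (suc (suc c))) l 0 * ℕ→ℚ (suc c !))
      ≡⟨ cong -_ (fallingFactorial-at-0 (suc c) l) ⟩
    - (sgn l * ℕ→ℚ ((suc c ℕ.+ l) !))
      ≡⟨ cong (λ n → - (sgn l * ℕ→ℚ (n !))) (sym (ℕₚ.+-suc c l)) ⟩
    - (sgn l * ℕ→ℚ ((c ℕ.+ suc l) !))
      ≡⟨ ℚₚ.neg-distribˡ-* (sgn l) _ ⟩
    sgn (suc l) * ℕ→ℚ ((c ℕ.+ suc l) !) ∎
    where
    open ≡-Reasoning
    next : ℕ→ℚ (suc c) + 1ℚ ≡ ℕ→ℚ (suc (suc c))
    next = trans (ℚₚ.+-comm (ℕ→ℚ (suc c)) 1ℚ) (sym (ℕ→ℚ-suc (suc c)))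
    reassoc : ∀ a x f → - (a * x) * f ≡ - (x * (a * f))
    reassoc = solve-∀ ℚ-ring

  fallingFactorial-root : ∀ s l → fallingFactorial (- ℕ→ℚ s) (suc (s ℕ.+ l)) 0 ≡ 0ℚ
  fallingFactorial-root zero    l = trans ([X-]*-at-0 (- ℕ→ℚ 0) ff₀) (cong -_ (ℚₚ.*-zeroˡ (ff₀ 0)))
    where
    ff₀ : Poly
    ff₀ = fallingFactorial (- ℕ→ℚ 0 + 1ℚ) l
  fallingFactorial-root (suc s) l = begin
    fallingFactorial a (suc (suc s ℕ.+ l)) 0
      ≡⟨ [X-]*-at-0 a (fallingFactorial (a + 1ℚ) (suc (s ℕ.+ l))) ⟩
    - (a * fallingFactorial (a + 1ℚ) (suc (s ℕ.+ l)) 0)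
      ≡⟨ cong (λ b → - (a * fallingFactorial b (suc (s ℕ.+ l)) 0)) (neg-ℕ→ℚ-suc+1 s) ⟩
    - (a * fallingFactorial (- ℕ→ℚ s) (suc (s ℕ.+ l)) 0)
      ≡⟨ cong (λ x → - (a * x)) (fallingFactorial-root s l) ⟩
    - (a * 0ℚ)
      ≡⟨ cong -_ (ℚₚ.*-zeroʳ a) ⟩
    0ℚ ∎
    where
    open ≡-Reasoning
    a : ℚ
    a = - ℕ→ℚ (suc s)

  fallingFactorial-root-slope : ∀ s l →
    fallingFactorial (- ℕ→ℚ s) (suc (s ℕ.+ l)) 1 ≡ ℕ→ℚ (s !) * fallingFactorial 1ℚ l 0
  fallingFactorial-root-slope zero    l = drop (fallingFactorial 1ℚ l 0) (fallingFactorial 1ℚ l 1)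
    where
    drop : ∀ x y → x - 0ℚ * y ≡ 1ℚ * x
    drop = solve-∀ ℚ-ring
  fallingFactorial-root-slope (suc s) l = begin
    P (a + 1ℚ) 0 - a * P (a + 1ℚ) 1
      ≡⟨ cong (λ b → P b 0 - a * P b 1) (neg-ℕ→ℚ-suc+1 s) ⟩
    P (- ℕ→ℚ s) 0 - a * P (- ℕ→ℚ s) 1
      ≡⟨ cong₂ (λ x y → x - a * y) (fallingFactorial-root s l) (fallingFactorial-root-slope s l) ⟩
    0ℚ - a * (ℕ→ℚ (s !) * fallingFactorial 1ℚ l 0)
      ≡⟨ regroup (ℕ→ℚ (suc s)) (ℕ→ℚ (s !)) (fallingFactorial 1ℚ l 0) ⟩
    ℕ→ℚ (suc s) * ℕ→ℚ (s !) * fallingFactorial 1ℚ l 0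
      ≡⟨ cong (_* fallingFactorial 1ℚ l 0) (sym (ℕ→ℚ-homo-* (suc s) (s !))) ⟩
    ℕ→ℚ (suc s !) * fallingFactorial 1ℚ l 0 ∎
    where
    open ≡-Reasoning
    a : ℚ
    a = - ℕ→ℚ (suc s)
    P : ℚ → Poly
    P b = fallingFactorial b (suc (s ℕ.+ l))
    regroup : ∀ n f y → 0ℚ - - n * (f * y) ≡ n * f * y
    regroup = solve-∀ ℚ-ring

  apply-cong : ∀ g N {c d} → c ≗ d → apply g N c ≡ apply g N d
  apply-cong g N c≗d = sumTo-cong N (λ i → cong (_* g i) (c≗d i))

  apply-distrib-+ : ∀ g N c d → apply g N (λ i → c i + d i) ≡ apply g N c + apply g N d
  apply-distrib-+ g N c d = trans (sumTo-cong N (λ i → ℚₚ.*-distribʳ-+ (g i) (c i) (d i))) (sumTo-distrib-+ N _ _)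

  apply-*ˡ : ∀ g N a c → apply g N (λ i → a * c i) ≡ a * apply g N c
  apply-*ˡ g N a c = trans (sumTo-cong N (λ i → ℚₚ.*-assoc a (c i) (g i))) (sumTo-distribˡ-* N a _)

  apply-shift : ∀ g N c → apply g N (shift N c) ≡ sumTo N (λ k → c k * sumTo k (λ i → ℕ→ℚ (k C i) * g i))
  apply-shift g N c = begin
    sumTo N (λ i → shift N c i * g i)
      ≡⟨ sumTo-cong N (λ i → sumTo-distribʳ-* N (g i) (λ k → ℕ→ℚ (k C i) * c k)) ⟨
    sumTo N (λ i → sumTo N (λ k → ℕ→ℚ (k C i) * c k * g i))
      ≡⟨ sumTo-swap N N (λ i k → ℕ→ℚ (k C i) * c k * g i) ⟩
    sumTo N (λ k → sumTo N (λ i → ℕ→ℚ (k C i) * c k * g i))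
      ≡⟨ sumTo-cong-≤ N inner ⟩
    sumTo N (λ k → c k * sumTo k (λ i → ℕ→ℚ (k C i) * g i)) ∎
    where
    open ≡-Reasoning
    reorder : ∀ b x y → b * x * y ≡ x * (b * y)
    reorder = solve-∀ ℚ-ring
    binomial-vanish : ∀ k i → k < i → ℕ→ℚ (k C i) * g i ≡ 0ℚ
    binomial-vanish k i k<i = trans (cong (λ n → ℕ→ℚ n * g i) (k>n⇒nCk≡0 k<i)) (ℚₚ.*-zeroˡ (g i))
    inner : ∀ k → k ≤ N → sumTo N (λ i → ℕ→ℚ (k C i) * c k * g i) ≡ c k * sumTo k (λ i → ℕ→ℚ (k C i) * g i)
    inner k k≤N = begin
      sumTo N (λ i → ℕ→ℚ (k C i) * c k * g i)
        ≡⟨ sumTo-cong N (λ i → reorder (ℕ→ℚ (k C i)) (c k) (g i)) ⟩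
      sumTo N (λ i → c k * (ℕ→ℚ (k C i) * g i))
        ≡⟨ sumTo-distribˡ-* N (c k) (λ i → ℕ→ℚ (k C i) * g i) ⟩
      c k * sumTo N (λ i → ℕ→ℚ (k C i) * g i)
        ≡⟨ cong (c k *_) (sumTo-vanishing-tail (λ i → ℕ→ℚ (k C i) * g i) k≤N (binomial-vanish k)) ⟩
      c k * sumTo k (λ i → ℕ→ℚ (k C i) * g i) ∎

module CentralFactorial where

  open import Data.Rational.Base using (_+_; _*_; -_; _-_)
  open Arithmetic
  open Sums
  open Polynomials

  cfn-high : ∀ k j → k < j → cfn k j ≡ + 0
  cfn-high zero    (suc j) _         = refl
  cfn-high (suc k) (suc j) (s≤s k<j) = trans
    (cong₂ (λ x y → x ℤ.- + (k ℕ.* k) ℤ.* y) (cfn-high k j k<j) (cfn-high k (suc j) (ℕₚ.m<n⇒m<1+n k<j)))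
    (cong (λ z → + 0 ℤ.- z) (ℤₚ.*-zeroʳ (+ (k ℕ.* k))))

  cfn-suc : ∀ m j → ℤ→ℚ (cfn (suc m) (suc j)) ≡ ℤ→ℚ (cfn m j) - ℕ→ℚ (m ℕ.* m) * ℤ→ℚ (cfn m (suc j))
  cfn-suc m j = trans (ℤ→ℚ-homo-sub (cfn m j) (+ (m ℕ.* m) ℤ.* cfn m (suc j)))
                      (cong (λ x → ℤ→ℚ (cfn m j) - x) (ℤ→ℚ-homo-* (+ (m ℕ.* m)) (cfn m (suc j))))

  cfnSum : ℕ → (ℕ → ℚ) → ℚ
  cfnSum m h = sumTo m (λ j → ℤ→ℚ (cfn m j) * h j)

  cfnSum-cong : ∀ m {h h′ : ℕ → ℚ} → h ≗ h′ → cfnSum m h ≡ cfnSum m h′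
  cfnSum-cong m h≗h′ = sumTo-cong m (λ j → cong (ℤ→ℚ (cfn m j) *_) (h≗h′ j))

  cfnSum-neg : ∀ m (h : ℕ → ℚ) → cfnSum m (λ j → - h j) ≡ - cfnSum m h
  cfnSum-neg m h = trans (sumTo-cong m (λ j → sym (ℚₚ.neg-distribʳ-* (ℤ→ℚ (cfn m j)) (h j))))
                         (sumTo-neg m (λ j → ℤ→ℚ (cfn m j) * h j))

  -- the factor m² absorbs the boundary term t(m, 0) h 0, which is nonzero only for m = 0
  cfnSum-shift : ∀ m (h : ℕ → ℚ) →
    ℕ→ℚ (m ℕ.* m) * sumTo m (λ j → ℤ→ℚ (cfn m (suc j)) * h (suc j)) ≡ ℕ→ℚ (m ℕ.* m) * cfnSum m h
  cfnSum-shift zero    h = trans (ℚₚ.*-zeroˡ (ℤ→ℚ (cfn 0 1) * h 1)) (sym (ℚₚ.*-zeroˡ (cfnSum 0 h)))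
  cfnSum-shift (suc k) h = cong (ℕ→ℚ (suc k ℕ.* suc k) *_) (begin
    sumTo k t + ℤ→ℚ (cfn (suc k) (suc (suc k))) * h (suc (suc k))
      ≡⟨ cong (λ z → sumTo k t + ℤ→ℚ z * h (suc (suc k))) (cfn-high (suc k) (suc (suc k)) ℕₚ.≤-refl) ⟩
    sumTo k t + 0ℚ * h (suc (suc k))
      ≡⟨ swap (sumTo k t) (h (suc (suc k))) (h 0) ⟩
    0ℚ * h 0 + sumTo k t
      ≡⟨ sumTo-head k (λ j → ℤ→ℚ (cfn (suc k) j) * h j) ⟨
    cfnSum (suc k) h ∎)
    where
    open ≡-Reasoning
    t : ℕ → ℚ
    t j = ℤ→ℚ (cfn (suc k) (suc j)) * h (suc j)
    swap : ∀ s x y → s + 0ℚ * x ≡ 0ℚ * y + s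
    swap = solve-∀ ℚ-ring

  cfnSum-suc : ∀ m (h : ℕ → ℚ) → cfnSum (suc m) h ≡ cfnSum m (h ∘ suc) - ℕ→ℚ (m ℕ.* m) * cfnSum m h
  cfnSum-suc m h = begin
    cfnSum (suc m) h
      ≡⟨ sumTo-head m (λ j → ℤ→ℚ (cfn (suc m) j) * h j) ⟩
    0ℚ * h 0 + sumTo m (λ j → ℤ→ℚ (cfn (suc m) (suc j)) * h (suc j))
      ≡⟨ cong₂ _+_ (ℚₚ.*-zeroˡ (h 0)) (sumTo-cong m (λ j → trans (cong (_* h (suc j)) (cfn-suc m j))
                                                                 (distrib (t j) m² (t′ j) (h (suc j))))) ⟩
    0ℚ + sumTo m (λ j → t j * h (suc j) - m² * (t′ j * h (suc j)))
      ≡⟨ ℚₚ.+-identityˡ _ ⟩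
    sumTo m (λ j → t j * h (suc j) - m² * (t′ j * h (suc j)))
      ≡⟨ sumTo-sub m _ _ ⟩
    cfnSum m (h ∘ suc) - sumTo m (λ j → m² * (t′ j * h (suc j)))
      ≡⟨ cong (λ x → cfnSum m (h ∘ suc) - x) (trans (sumTo-distribˡ-* m m² _) (cfnSum-shift m h)) ⟩
    cfnSum m (h ∘ suc) - m² * cfnSum m h ∎
    where
    open ≡-Reasoning
    m² : ℚ
    m² = ℕ→ℚ (m ℕ.* m)
    t t′ : ℕ → ℚ
    t  j = ℤ→ℚ (cfn m j)
    t′ j = ℤ→ℚ (cfn m (suc j))
    distrib : ∀ x a y z → (x - a * y) * z ≡ x * z - a * (y * z)
    distrib = solve-∀ ℚ-ring

  evenPoly : (ℕ → ℚ) → Poly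
  evenPoly f zero          = f 0
  evenPoly f (suc zero)    = 0ℚ
  evenPoly f (suc (suc i)) = evenPoly (f ∘ suc) i

  evenPoly-cong : ∀ {f f′ : ℕ → ℚ} → f ≗ f′ → evenPoly f ≗ evenPoly f′
  evenPoly-cong f≗f′ zero          = f≗f′ 0
  evenPoly-cong f≗f′ (suc zero)    = refl
  evenPoly-cong f≗f′ (suc (suc i)) = evenPoly-cong (f≗f′ ∘ suc) i

  evenPoly-zero : ∀ (f : ℕ → ℚ) → (∀ j → f j ≡ 0ℚ) → ∀ i → evenPoly f i ≡ 0ℚ
  evenPoly-zero f f≡0 zero          = f≡0 0
  evenPoly-zero f f≡0 (suc zero)    = refl
  evenPoly-zero f f≡0 (suc (suc i)) = evenPoly-zero (f ∘ suc) (f≡0 ∘ suc) i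

  evenPoly-sub-* : ∀ (f g : ℕ → ℚ) a → evenPoly (λ j → f j - a * g j) ≗ λ i → evenPoly f i - a * evenPoly g i
  evenPoly-sub-* f g a zero          = refl
  evenPoly-sub-* f g a (suc zero)    = sym (vanish a)
    where
    vanish : ∀ a → 0ℚ - a * 0ℚ ≡ 0ℚ
    vanish = solve-∀ ℚ-ring
  evenPoly-sub-* f g a (suc (suc i)) = evenPoly-sub-* (f ∘ suc) (g ∘ suc) a i

  -- Σⱼ t(k, j) X²ʲ, which is X²(X² − 1²) ⋯ (X² − (k − 1)²) for k ≥ 1
  cfPoly : ℕ → Poly
  cfPoly k = evenPoly (λ j → ℤ→ℚ (cfn k j))

  cfPoly-zero : cfPoly 0 ≗ one
  cfPoly-zero zero          = refl
  cfPoly-zero (suc zero)    = refl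
  cfPoly-zero (suc (suc i)) = evenPoly-zero (λ j → ℤ→ℚ (cfn 0 (suc j))) (λ _ → refl) i

  cfPoly-suc : ∀ k → cfPoly (suc k) ≗ [X- - ℕ→ℚ k ]* [X- ℕ→ℚ k ]* cfPoly k
  cfPoly-suc zero    zero = root₀ (ℤ→ℚ (cfn 0 0))
    where
    root₀ : ∀ x → 0ℚ ≡ 0ℚ - - 0ℚ * (0ℚ - 0ℚ * x)
    root₀ = solve-∀ ℚ-ring
  cfPoly-suc (suc k) zero = root₀ (ℕ→ℚ (suc k))
    where
    root₀ : ∀ a → 0ℚ ≡ 0ℚ - - a * (0ℚ - a * 0ℚ)
    root₀ = solve-∀ ℚ-ring
  cfPoly-suc k (suc zero) = root₁ (ℕ→ℚ k) (ℤ→ℚ (cfn k 0))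
    where
    root₁ : ∀ a x → 0ℚ ≡ (0ℚ - a * x) - - a * (x - a * 0ℚ)
    root₁ = solve-∀ ℚ-ring
  cfPoly-suc k (suc (suc j)) = begin
    evenPoly (λ i → ℤ→ℚ (cfn (suc k) (suc i))) j
      ≡⟨ evenPoly-cong (cfn-suc k) j ⟩
    evenPoly (λ i → ℤ→ℚ (cfn k i) - ℕ→ℚ (k ℕ.* k) * ℤ→ℚ (cfn k (suc i))) j
      ≡⟨ evenPoly-sub-* (λ i → ℤ→ℚ (cfn k i)) (λ i → ℤ→ℚ (cfn k (suc i))) (ℕ→ℚ (k ℕ.* k)) j ⟩
    U j - ℕ→ℚ (k ℕ.* k) * U (suc (suc j))
      ≡⟨ cong (λ a² → U j - a² * U (suc (suc j))) (ℕ→ℚ-homo-* k k) ⟩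
    U j - ℕ→ℚ k * ℕ→ℚ k * U (suc (suc j))
      ≡⟨ factor (ℕ→ℚ k) (U j) (U (suc j)) (U (suc (suc j))) ⟩
    (U j - ℕ→ℚ k * U (suc j)) - - ℕ→ℚ k * (U (suc j) - ℕ→ℚ k * U (suc (suc j))) ∎
    where
    open ≡-Reasoning
    U : Poly
    U = cfPoly k
    factor : ∀ a x y z → x - a * a * z ≡ (x - a * y) - - a * (y - a * z)
    factor = solve-∀ ℚ-ring

  X*fallingFactorial≗cfPoly : ∀ s → X* fallingFactorial (- ℕ→ℚ s) (s ℕ.+ suc s) ≗ cfPoly (suc s)
  X*fallingFactorial≗cfPoly zero = begin
    X* [X- - ℕ→ℚ 0 ]* one              ≈⟨ X*-[X-]*-comm (- ℕ→ℚ 0) one ⟩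
    [X- - ℕ→ℚ 0 ]* X* one              ≈⟨ [X-]*-cong (- ℕ→ℚ 0) X*one ⟩
    [X- - ℕ→ℚ 0 ]* [X- ℕ→ℚ 0 ]* one    ≈⟨ [X-]*-cong (- ℕ→ℚ 0) ([X-]*-cong (ℕ→ℚ 0) cfPoly-zero) ⟨
    [X- - ℕ→ℚ 0 ]* [X- ℕ→ℚ 0 ]* cfPoly 0 ≈⟨ cfPoly-suc 0 ⟨
    cfPoly 1                            ∎
    where
    open ≗-Reasoning
    X*one : X* one ≗ [X- ℕ→ℚ 0 ]* one
    X*one zero          = refl
    X*one (suc zero)    = refl
    X*one (suc (suc i)) = refl
  X*fallingFactorial≗cfPoly (suc s) = begin
    X* fallingFactorial a (suc s ℕ.+ suc (suc s))
      ≡⟨ cong (λ n → X* fallingFactorial a (suc n)) (ℕₚ.+-suc s (suc s)) ⟩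
    X* [X- a ]* fallingFactorial (a + 1ℚ) (suc L)
      ≡⟨ cong (λ b → X* [X- a ]* fallingFactorial b (suc L)) (neg-ℕ→ℚ-suc+1 s) ⟩
    X* [X- a ]* fallingFactorial (- ℕ→ℚ s) (suc L)
      ≈⟨ X*-cong ([X-]*-cong a (fallingFactorial-sucʳ (- ℕ→ℚ s) L)) ⟩
    X* [X- a ]* [X- - ℕ→ℚ s + ℕ→ℚ L ]* Z
      ≡⟨ cong (λ b → X* [X- a ]* [X- b ]* Z) middle ⟩
    X* [X- a ]* [X- ℕ→ℚ (suc s) ]* Z
      ≈⟨ X*-[X-]*-comm a _ ⟩
    [X- a ]* X* [X- ℕ→ℚ (suc s) ]* Z
      ≈⟨ [X-]*-cong a (X*-[X-]*-comm (ℕ→ℚ (suc s)) Z) ⟩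
    [X- a ]* [X- ℕ→ℚ (suc s) ]* X* Z
      ≈⟨ [X-]*-cong a ([X-]*-cong (ℕ→ℚ (suc s)) (X*fallingFactorial≗cfPoly s)) ⟩
    [X- a ]* [X- ℕ→ℚ (suc s) ]* cfPoly (suc s)
      ≈⟨ cfPoly-suc (suc s) ⟨
    cfPoly (suc (suc s)) ∎
    where
    open ≗-Reasoning
    a : ℚ
    a = - ℕ→ℚ (suc s)
    L : ℕ
    L = s ℕ.+ suc s
    Z : Poly
    Z = fallingFactorial (- ℕ→ℚ s) L
    cancel : ∀ x y → - x + (x + y) ≡ y
    cancel = solve-∀ ℚ-ring
    middle : - ℕ→ℚ s + ℕ→ℚ L ≡ ℕ→ℚ (suc s)
    middle = trans (cong (λ y → - ℕ→ℚ s + y) (ℕ→ℚ-homo-+ s (suc s))) (cancel (ℕ→ℚ s) (ℕ→ℚ (suc s)))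

  apply-evenPoly : ∀ k (f h : ℕ → ℚ) → apply h (suc (k ℕ.+ k)) (evenPoly f) ≡ sumTo k (λ j → f j * h (j ℕ.+ j))
  apply-evenPoly zero    f h = drop (f 0 * h 0) (h 1)
    where
    drop : ∀ x y → x + 0ℚ * y ≡ x
    drop = solve-∀ ℚ-ring
  apply-evenPoly (suc k) f h = begin
    sumTo (suc (suc (k ℕ.+ suc k))) (λ i → evenPoly f i * h i)
      ≡⟨ cong (λ n → sumTo (suc (suc n)) (λ i → evenPoly f i * h i)) (ℕₚ.+-suc k k) ⟩
    sumTo (suc (suc (suc (k ℕ.+ k)))) (λ i → evenPoly f i * h i)
      ≡⟨ sumTo-head (suc (suc (k ℕ.+ k))) (λ i → evenPoly f i * h i) ⟩
    f 0 * h 0 + sumTo (suc (suc (k ℕ.+ k))) (λ i → evenPoly f (suc i) * h (suc i))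
      ≡⟨ cong (λ x → f 0 * h 0 + x) (sumTo-head (suc (k ℕ.+ k)) (λ i → evenPoly f (suc i) * h (suc i))) ⟩
    f 0 * h 0 + (0ℚ * h 1 + apply (h ∘ suc ∘ suc) (suc (k ℕ.+ k)) (evenPoly (f ∘ suc)))
      ≡⟨ cong (λ x → f 0 * h 0 + (0ℚ * h 1 + x)) (apply-evenPoly k (f ∘ suc) (h ∘ suc ∘ suc)) ⟩
    f 0 * h 0 + (0ℚ * h 1 + sumTo k (λ j → f (suc j) * h (suc (suc (j ℕ.+ j)))))
      ≡⟨ drop (f 0 * h 0) (h 1) _ ⟩
    f 0 * h 0 + sumTo k (λ j → f (suc j) * h (suc (suc (j ℕ.+ j))))
      ≡⟨ cong (λ x → f 0 * h 0 + x) (sumTo-cong k (λ j → cong (λ n → f (suc j) * h (suc n)) (ℕₚ.+-suc j j))) ⟨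
    f 0 * h 0 + sumTo k (λ j → f (suc j) * h (suc j ℕ.+ suc j))
      ≡⟨ sumTo-head k (λ j → f j * h (j ℕ.+ j)) ⟨
    sumTo (suc k) (λ j → f j * h (j ℕ.+ j)) ∎
    where
    open ≡-Reasoning
    drop : ∀ x y z → x + (0ℚ * y + z) ≡ x + z
    drop = solve-∀ ℚ-ring

module Gandhi where

  open import Data.Rational.Base using (_+_; _*_; -_; _-_)
  open Arithmetic

  F-suc : ∀ n m → ℤ→ℚ (F (suc (suc n)) (+ m))
                  ≡ ℕ→ℚ (suc m ℕ.* suc m) * ℤ→ℚ (F (suc n) (+ suc m)) - ℕ→ℚ (m ℕ.* m) * ℤ→ℚ (F (suc n) (+ m))
  F-suc n m = begin
    ℤ→ℚ (F (suc (suc n)) (+ m))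
      ≡⟨ cong (λ z → ℤ→ℚ ((z ℤ.* z) ℤ.* F (suc n) z ℤ.- (+ m ℤ.* + m) ℤ.* F (suc n) (+ m)))
              (cong (λ k → + k) (ℕₚ.+-comm m 1)) ⟩
    ℤ→ℚ ((+ suc m ℤ.* + suc m) ℤ.* F (suc n) (+ suc m) ℤ.- (+ m ℤ.* + m) ℤ.* F (suc n) (+ m))
      ≡⟨ ℤ→ℚ-homo-sub ((+ suc m ℤ.* + suc m) ℤ.* F (suc n) (+ suc m)) ((+ m ℤ.* + m) ℤ.* F (suc n) (+ m)) ⟩
    ℤ→ℚ ((+ suc m ℤ.* + suc m) ℤ.* F (suc n) (+ suc m)) - ℤ→ℚ ((+ m ℤ.* + m) ℤ.* F (suc n) (+ m))
      ≡⟨ cong₂ _-_ (square (suc m) (F (suc n) (+ suc m))) (square m (F (suc n) (+ m))) ⟩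
    ℕ→ℚ (suc m ℕ.* suc m) * ℤ→ℚ (F (suc n) (+ suc m)) - ℕ→ℚ (m ℕ.* m) * ℤ→ℚ (F (suc n) (+ m)) ∎
    where
    open ≡-Reasoning
    square : ∀ k z → ℤ→ℚ ((+ k ℤ.* + k) ℤ.* z) ≡ ℕ→ℚ (k ℕ.* k) * ℤ→ℚ z
    square k z = trans (ℤ→ℚ-homo-* (+ k ℤ.* + k) z) (cong (λ w → ℤ→ℚ w * ℤ→ℚ z) (sym (ℤₚ.pos-* k k)))

module Genocchi (G : ℕ → ℚ) (isG : IsGenocchi G) where

  open import Data.Rational.Base using (_+_; _*_; -_; _-_)
  open Arithmetic
  open Sums
  open Polynomials
  open CentralFactorial
  open Gandhi

  g : ℕ → ℚ
  g = genCoef G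

  apply-shift+apply : ∀ M c → apply g (suc M) (shift (suc M) c) + apply g (suc M) c ≡ ℕ→ℚ 2 * c 1
  apply-shift+apply M c = begin
    apply g N (shift N c) + apply g N c
      ≡⟨ cong (_+ apply g N c) (apply-shift g N c) ⟩
    sumTo N (λ k → c k * binomialSum k) + apply g N c
      ≡⟨ sumTo-distrib-+ N (λ k → c k * binomialSum k) (λ k → c k * g k) ⟨
    sumTo N (λ k → c k * binomialSum k + c k * g k)
      ≡⟨ sumTo-cong N (λ k → trans (sym (ℚₚ.*-distribˡ-+ (c k) (binomialSum k) (g k))) (cong (c k *_) (isG k))) ⟩
    sumTo N (λ k → c k * (if k ≡ᵇ 1 then ℕ→ℚ 2 else 0ℚ))
      ≡⟨ sum-at-1 M ⟩
    ℕ→ℚ 2 * c 1 ∎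
    where
    open ≡-Reasoning
    N : ℕ
    N = suc M
    binomialSum : ℕ → ℚ
    binomialSum k = sumTo k (λ i → ℕ→ℚ (k C i) * g i)
    sum-at-1 : ∀ M → sumTo (suc M) (λ k → c k * (if k ≡ᵇ 1 then ℕ→ℚ 2 else 0ℚ)) ≡ ℕ→ℚ 2 * c 1
    sum-at-1 zero    = two (c 0) (c 1)
      where
      two : ∀ x y → x * 0ℚ + y * ℕ→ℚ 2 ≡ ℕ→ℚ 2 * y
      two = solve-∀ ℚ-ring
    sum-at-1 (suc M) =
      trans (cong (_+ c (suc (suc M)) * 0ℚ) (sum-at-1 M)) (drop (ℕ→ℚ 2 * c 1) (c (suc (suc M))))
      where
      drop : ∀ x y → x + y * 0ℚ ≡ x
      drop = solve-∀ ℚ-ring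

  apply-X*fallingFactorial : ∀ s →
    apply g (suc (suc (s ℕ.+ suc s))) (X* fallingFactorial (- ℕ→ℚ s) (s ℕ.+ suc s))
      ≡ sgn (suc s) * ℕ→ℚ (s ! ℕ.* suc s !)
  apply-X*fallingFactorial s = 2*-injective (begin
    ℕ→ℚ 2 * apply g N (X* Z)
      ≡⟨ apply-*ˡ g N (ℕ→ℚ 2) (X* Z) ⟨
    apply g N (λ i → ℕ→ℚ 2 * (X* Z) i)
      ≡⟨ apply-cong g N ([X-]*-+-[X-]* (a - 1ℚ) (a + ℕ→ℚ L) Z opposite) ⟨
    apply g N (λ i → ([X- a - 1ℚ ]* Z) i + ([X- a + ℕ→ℚ L ]* Z) i)
      ≡⟨ apply-distrib-+ g N ([X- a - 1ℚ ]* Z) ([X- a + ℕ→ℚ L ]* Z) ⟩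
    apply g N ([X- a - 1ℚ ]* Z) + apply g N ([X- a + ℕ→ℚ L ]* Z)
      ≡⟨ cong₂ _+_ (apply-cong g N shift-W) (apply-cong g N (fallingFactorial-sucʳ a L)) ⟨
    apply g N (shift N W) + apply g N W
      ≡⟨ apply-shift+apply (suc L) W ⟩
    ℕ→ℚ 2 * W 1
      ≡⟨ cong (ℕ→ℚ 2 *_) slope ⟩
    ℕ→ℚ 2 * (sgn (suc s) * ℕ→ℚ (s ! ℕ.* suc s !)) ∎)
    where
    open ≡-Reasoning
    a : ℚ
    a = - ℕ→ℚ s
    L N : ℕ
    L = s ℕ.+ suc s
    N = suc (suc L)
    Z W : Poly
    Z = fallingFactorial a L
    W = fallingFactorial a (suc L)
    cancel : ∀ a → a - 1ℚ + 1ℚ ≡ a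
    cancel = solve-∀ ℚ-ring
    shift-W : shift N W ≗ [X- a - 1ℚ ]* Z
    shift-W i = trans (shift-fallingFactorial (suc L) a (suc L) ℕₚ.≤-refl i)
                      (cong (λ b → ([X- a - 1ℚ ]* fallingFactorial b L) i) (cancel a))
    sum-zero : ∀ x → (- x - 1ℚ) + (- x + (x + (1ℚ + x))) ≡ 0ℚ
    sum-zero = solve-∀ ℚ-ring
    L-cast : ℕ→ℚ L ≡ ℕ→ℚ s + (1ℚ + ℕ→ℚ s)
    L-cast = trans (ℕ→ℚ-homo-+ s (suc s)) (cong (λ y → ℕ→ℚ s + y) (ℕ→ℚ-suc s))
    opposite : (a - 1ℚ) + (a + ℕ→ℚ L) ≡ 0ℚ
    opposite = trans (cong (λ y → (a - 1ℚ) + (a + y)) L-cast) (sum-zero (ℕ→ℚ s))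
    reorder : ∀ f σ y → f * (σ * y) ≡ σ * (f * y)
    reorder = solve-∀ ℚ-ring
    slope : W 1 ≡ sgn (suc s) * ℕ→ℚ (s ! ℕ.* suc s !)
    slope = begin
      W 1
        ≡⟨ fallingFactorial-root-slope s (suc s) ⟩
      ℕ→ℚ (s !) * fallingFactorial 1ℚ (suc s) 0
        ≡⟨ cong (ℕ→ℚ (s !) *_) (trans (sym (ℚₚ.*-identityʳ _)) (fallingFactorial-at-0 0 (suc s))) ⟩
      ℕ→ℚ (s !) * (sgn (suc s) * ℕ→ℚ (suc s !))
        ≡⟨ reorder (ℕ→ℚ (s !)) (sgn (suc s)) (ℕ→ℚ (suc s !)) ⟩
      sgn (suc s) * (ℕ→ℚ (s !) * ℕ→ℚ (suc s !))
        ≡⟨ cong (sgn (suc s) *_) (ℕ→ℚ-homo-* (s !) (suc s !)) ⟨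
      sgn (suc s) * ℕ→ℚ (s ! ℕ.* suc s !) ∎

  evenG : ℕ → ℚ
  evenG j = g (j ℕ.+ j)

  evenG-suc : ∀ j → evenG (suc j) ≡ sgn (suc j) * G (suc j)
  evenG-suc j = begin
    g (suc j ℕ.+ suc j)                              ≡⟨ cong g (n+n≡n*2 (suc j)) ⟩
    g (suc j ℕ.* 2)                                  ≡⟨ at-even (suc j ℕ.* 2) refl (m*n%n≡0 (suc j) 2) refl ⟩
    sgn (suc j ℕ.* 2 ℕ./ 2) * G (suc j ℕ.* 2 ℕ./ 2)  ≡⟨ cong (λ k → sgn k * G k) (m*n/n≡m (suc j) 2) ⟩
    sgn (suc j) * G (suc j)                          ∎
    where
    open ≡-Reasoning
    at-even : ∀ n → (n ≡ᵇ 1) ≡ false → n ℕ.% 2 ≡ 0 → (n ≡ᵇ 0) ≡ false → g n ≡ sgn (n ℕ./ 2) * G (n ℕ./ 2)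
    at-even n n≢1 even n≢0 rewrite n≢1 | even | n≢0 = refl

  cfnSum-evenG-suc : ∀ s → cfnSum (suc s) evenG ≡ sgn (suc s) * ℕ→ℚ (s ! ℕ.* suc s !)
  cfnSum-evenG-suc s = begin
    cfnSum (suc s) evenG
      ≡⟨ apply-evenPoly (suc s) (λ j → ℤ→ℚ (cfn (suc s) j)) g ⟨
    apply g (suc (suc s ℕ.+ suc s)) (cfPoly (suc s))
      ≡⟨ apply-cong g (suc (suc s ℕ.+ suc s)) (X*fallingFactorial≗cfPoly s) ⟨
    apply g (suc (suc (s ℕ.+ suc s))) (X* fallingFactorial (- ℕ→ℚ s) (s ℕ.+ suc s))
      ≡⟨ apply-X*fallingFactorial s ⟩
    sgn (suc s) * ℕ→ℚ (s ! ℕ.* suc s !) ∎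
    where open ≡-Reasoning

  m²*cfnSum-evenG : ∀ m → ℕ→ℚ (m ℕ.* m) * cfnSum m evenG ≡ sgn m * ℕ→ℚ (m ℕ.* (m ! ℕ.* m !))
  m²*cfnSum-evenG zero    = refl
  m²*cfnSum-evenG (suc s) = begin
    ℕ→ℚ (a ℕ.* a) * cfnSum a evenG
      ≡⟨ cong (ℕ→ℚ (a ℕ.* a) *_) (cfnSum-evenG-suc s) ⟩
    ℕ→ℚ (a ℕ.* a) * (sgn a * ℕ→ℚ (s ! ℕ.* a !))
      ≡⟨ swap (ℕ→ℚ (a ℕ.* a)) (sgn a) (ℕ→ℚ (s ! ℕ.* a !)) ⟩
    sgn a * (ℕ→ℚ (a ℕ.* a) * ℕ→ℚ (s ! ℕ.* a !))
      ≡⟨ cong (sgn a *_) (ℕ→ℚ-homo-* (a ℕ.* a) (s ! ℕ.* a !)) ⟨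
    sgn a * ℕ→ℚ ((a ℕ.* a) ℕ.* (s ! ℕ.* a !))
      ≡⟨ cong (λ n → sgn a * ℕ→ℚ n) (regroup a (s !)) ⟩
    sgn a * ℕ→ℚ (a ℕ.* (a ! ℕ.* a !)) ∎
    where
    open ≡-Reasoning
    a : ℕ
    a = suc s
    swap : ∀ x σ y → x * (σ * y) ≡ σ * (x * y)
    swap = solve-∀ ℚ-ring
    regroup : ∀ a f → (a ℕ.* a) ℕ.* (f ℕ.* (a ℕ.* f)) ≡ a ℕ.* ((a ℕ.* f) ℕ.* (a ℕ.* f))
    regroup = ℕ-Solver.solve-∀

  signedG : ℕ → ℕ → ℚ
  signedG n j = sgn j * G (suc n ℕ.+ j)

  cfnSum-signedG-0 : ∀ m → cfnSum m (signedG 0) ≡ - (cfnSum (suc m) evenG + ℕ→ℚ (m ℕ.* m) * cfnSum m evenG)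
  cfnSum-signedG-0 m = begin
    cfnSum m (signedG 0)
      ≡⟨ invert (cfnSum m (signedG 0)) (m² * cfnSum m evenG) ⟩
    - ((- cfnSum m (signedG 0) - m² * cfnSum m evenG) + m² * cfnSum m evenG)
      ≡⟨ cong (λ x → - ((x - m² * cfnSum m evenG) + m² * cfnSum m evenG)) evenG-shift ⟨
    - ((cfnSum m (evenG ∘ suc) - m² * cfnSum m evenG) + m² * cfnSum m evenG)
      ≡⟨ cong (λ x → - (x + m² * cfnSum m evenG)) (cfnSum-suc m evenG) ⟨
    - (cfnSum (suc m) evenG + m² * cfnSum m evenG) ∎
    where
    open ≡-Reasoning
    m² : ℚ
    m² = ℕ→ℚ (m ℕ.* m)
    invert : ∀ x y → x ≡ - ((- x - y) + y)
    invert = solve-∀ ℚ-ring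
    evenG-shift : cfnSum m (evenG ∘ suc) ≡ - cfnSum m (signedG 0)
    evenG-shift = trans
      (cfnSum-cong m (λ j → trans (evenG-suc j) (sym (ℚₚ.neg-distribˡ-* (sgn j) (G (suc j))))))
      (cfnSum-neg m (signedG 0))

  genocchiTransform : ℕ → ℕ → ℚ
  genocchiTransform n m = sgn m * cfnSum m (signedG n)

  genocchiTransform≡sum : ∀ n m →
    genocchiTransform n m ≡ sumTo m (λ j → sgn (m ℕ.+ j) * ℤ→ℚ (cfn m j) * G (suc n ℕ.+ j))
  genocchiTransform≡sum n m = trans
    (sym (sumTo-distribˡ-* m (sgn m) (λ j → ℤ→ℚ (cfn m j) * signedG n j)))
    (sumTo-cong m (λ j → trans (reorder (sgn m) (sgn j) (ℤ→ℚ (cfn m j)) (G (suc n ℕ.+ j)))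
                               (cong (λ σ → σ * ℤ→ℚ (cfn m j) * G (suc n ℕ.+ j)) (sym (sgn-homo-+ m j)))))
    where
    reorder : ∀ σ τ t x → σ * (t * (τ * x)) ≡ σ * τ * t * x
    reorder = solve-∀ ℚ-ring

  genocchiTransform-suc : ∀ n m →
    genocchiTransform n (suc m) ≡ genocchiTransform (suc n) m + ℕ→ℚ (m ℕ.* m) * genocchiTransform n m
  genocchiTransform-suc n m = begin
    sgn (suc m) * cfnSum (suc m) (signedG n)
      ≡⟨ cong (sgn (suc m) *_) (cfnSum-suc m (signedG n)) ⟩
    sgn (suc m) * (cfnSum m (signedG n ∘ suc) - m² * cfnSum m (signedG n))
      ≡⟨ cong (λ x → sgn (suc m) * (x - m² * cfnSum m (signedG n))) signedG-shift ⟩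
    sgn (suc m) * (- cfnSum m (signedG (suc n)) - m² * cfnSum m (signedG n))
      ≡⟨ regroup (sgn m) (cfnSum m (signedG (suc n))) m² (cfnSum m (signedG n)) ⟩
    sgn m * cfnSum m (signedG (suc n)) + m² * (sgn m * cfnSum m (signedG n)) ∎
    where
    open ≡-Reasoning
    m² : ℚ
    m² = ℕ→ℚ (m ℕ.* m)
    regroup : ∀ σ x b y → - σ * (- x - b * y) ≡ σ * x + b * (σ * y)
    regroup = solve-∀ ℚ-ring
    signedG-shift : cfnSum m (signedG n ∘ suc) ≡ - cfnSum m (signedG (suc n))
    signedG-shift = trans
      (cfnSum-cong m (λ j → trans (cong (λ k → - sgn j * G (suc k)) (ℕₚ.+-suc n j))
                                  (sym (ℚₚ.neg-distribˡ-* (sgn j) (G (suc (suc n ℕ.+ j)))))))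
      (cfnSum-neg m (signedG (suc n)))

  genocchiTransform-zero : ∀ m → genocchiTransform 0 m ≡ ℕ→ℚ (m ! ℕ.* m !)
  genocchiTransform-zero m = begin
    sgn m * cfnSum m (signedG 0)
      ≡⟨ cong (sgn m *_) (cfnSum-signedG-0 m) ⟩
    sgn m * - (cfnSum (suc m) evenG + ℕ→ℚ (m ℕ.* m) * cfnSum m evenG)
      ≡⟨ cong₂ (λ x y → sgn m * - (x + y)) (cfnSum-evenG-suc m) (m²*cfnSum-evenG m) ⟩
    sgn m * - (sgn (suc m) * ℕ→ℚ (m ! ℕ.* suc m !) + sgn m * B)
      ≡⟨ cong (λ x → sgn m * - (sgn (suc m) * x + sgn m * B)) split ⟩
    sgn m * - (- sgn m * (A + B) + sgn m * B)
      ≡⟨ collapse (sgn m) A B ⟩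
    sgn m * sgn m * A
      ≡⟨ cong (_* A) (sgn*sgn m) ⟩
    1ℚ * A
      ≡⟨ ℚₚ.*-identityˡ A ⟩
    A ∎
    where
    open ≡-Reasoning
    A B : ℚ
    A = ℕ→ℚ (m ! ℕ.* m !)
    B = ℕ→ℚ (m ℕ.* (m ! ℕ.* m !))
    expand : ∀ m f → f ℕ.* (f ℕ.+ m ℕ.* f) ≡ f ℕ.* f ℕ.+ m ℕ.* (f ℕ.* f)
    expand = ℕ-Solver.solve-∀
    split : ℕ→ℚ (m ! ℕ.* suc m !) ≡ A + B
    split = trans (cong ℕ→ℚ (expand m (m !))) (ℕ→ℚ-homo-+ (m ! ℕ.* m !) (m ℕ.* (m ! ℕ.* m !)))
    collapse : ∀ σ x y → σ * - (- σ * (x + y) + σ * y) ≡ σ * σ * x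
    collapse = solve-∀ ℚ-ring

  F*factorial²≡genocchiTransform : ∀ n m → ℤ→ℚ (F (suc n) (+ m)) * ℕ→ℚ (m ! ℕ.* m !) ≡ genocchiTransform n m
  F*factorial²≡genocchiTransform zero    m =
    trans (ℚₚ.*-identityˡ (ℕ→ℚ (m ! ℕ.* m !))) (sym (genocchiTransform-zero m))
  F*factorial²≡genocchiTransform (suc n) m = begin
    ℤ→ℚ (F (suc (suc n)) (+ m)) * ℕ→ℚ (m ! ℕ.* m !)
      ≡⟨ cong (_* ℕ→ℚ (m ! ℕ.* m !)) (F-suc n m) ⟩
    (ℕ→ℚ (suc m ℕ.* suc m) * f₁ - m² * f₀) * ℕ→ℚ (m ! ℕ.* m !)
      ≡⟨ distrib (ℕ→ℚ (suc m ℕ.* suc m)) f₁ m² f₀ (ℕ→ℚ (m ! ℕ.* m !)) ⟩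
    f₁ * (ℕ→ℚ (suc m ℕ.* suc m) * ℕ→ℚ (m ! ℕ.* m !)) - m² * (f₀ * ℕ→ℚ (m ! ℕ.* m !))
      ≡⟨ cong (λ x → f₁ * x - m² * (f₀ * ℕ→ℚ (m ! ℕ.* m !))) (factorial²-suc m) ⟨
    f₁ * ℕ→ℚ (suc m ! ℕ.* suc m !) - m² * (f₀ * ℕ→ℚ (m ! ℕ.* m !))
      ≡⟨ cong₂ (λ x y → x - m² * y) (F*factorial²≡genocchiTransform n (suc m))
                                    (F*factorial²≡genocchiTransform n m) ⟩
    genocchiTransform n (suc m) - m² * genocchiTransform n m
      ≡⟨ cong (λ x → x - m² * genocchiTransform n m) (genocchiTransform-suc n m) ⟩
    genocchiTransform (suc n) m + m² * genocchiTransform n m - m² * genocchiTransform n m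
      ≡⟨ cancel (genocchiTransform (suc n) m) (m² * genocchiTransform n m) ⟩
    genocchiTransform (suc n) m ∎
    where
    open ≡-Reasoning
    m² f₀ f₁ : ℚ
    m² = ℕ→ℚ (m ℕ.* m)
    f₀ = ℤ→ℚ (F (suc n) (+ m))
    f₁ = ℤ→ℚ (F (suc n) (+ suc m))
    distrib : ∀ b x c y f → (b * x - c * y) * f ≡ x * (b * f) - c * (y * f)
    distrib = solve-∀ ℚ-ring
    cancel : ∀ x y → x + y - y ≡ x
    cancel = solve-∀ ℚ-ring

open import Data.Nat using (ℕ; suc; _+_; _*_; _!)
open import Data.Integer using (+_)
open import Data.Rational using (ℚ) renaming (_*_ to _*ℚ_)
open import Relation.Binary.PropositionalEquality using (_≡_)

proposition1 : (G : ℕ → ℚ) → IsGenocchi G → (n m : ℕ) →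
    ℤ→ℚ (F (suc n) (+ m)) *ℚ ℕ→ℚ ((m !) * (m !))
      ≡ sumTo m (λ j → sgn (m + j) *ℚ ℤ→ℚ (cfn m j) *ℚ G (suc n + j))
proposition1 G isG n m = begin
  ℤ→ℚ (F (suc n) (+ m)) *ℚ ℕ→ℚ ((m !) * (m !))          ≡⟨ F*factorial²≡genocchiTransform n m ⟩
  genocchiTransform n m                                   ≡⟨ genocchiTransform≡sum n m ⟩
  sumTo m (λ j → sgn (m + j) *ℚ ℤ→ℚ (cfn m j) *ℚ G (suc n + j)) ∎
  where
  open Genocchi G isG
  open ≡-Reasoning
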